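{- Let $G$ be a finite abelian group and $S\subset G$ a partial symmetric Sidon set with center $0$. If $T\subset G$ is a subset with $T\cap(-T)=\emptyset$, then $S\cap T$ is a Sidon set.
   Context: $S$ is a Sidon set if every solution $(\alpha,\beta,\gamma,\delta)\in S^4$ of $\alpha+\beta=\gamma+\delta$ has $\alpha\in\{\gamma,\delta\}$. $S$ is a partial symmetric Sidon set with center $a_0\in S$ if every solution $(\alpha,\beta,\gamma,\delta)\in S^4$ of $\alpha+\beta=\gamma+\delta$ satisfies either $\alpha\in\{\gamma,\delta\}$ or $\alpha+\beta=\gamma+\delta=a_0$. -}

module Defs where

open import Level using (Level; _⊔_; suc)
open import Algebra.Bundles using (AbelianGroup)
open import Data.Nat using (ℕ)
open import Data.Fin using (Fin)
open import Data.Product using (∃-syntax; _×_)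
open import Data.Sum using (_⊎_)
open import Data.Empty using (⊥)
open import Function.Bundles using (Inverse)
open import Relation.Unary using (Pred; _∩_)
import Relation.Binary.PropositionalEquality as ≡

module _ {c ℓ : Level} (G : AbelianGroup c ℓ) where
  open AbelianGroup G renaming (_∙_ to _+_; ε to 0#; _⁻¹ to -_)

  FiniteGroup : Set (c ⊔ ℓ)
  FiniteGroup = ∃[ n ] Inverse setoid (≡.setoid (Fin n))

  WellDefined : ∀ {p} → Pred Carrier p → Set (c ⊔ ℓ ⊔ p)
  WellDefined S = ∀ {x y} → x ≈ y → S x → S y

  IsSidon : ∀ {p} → Pred Carrier p → Set (c ⊔ ℓ ⊔ p)
  IsSidon S = ∀ α β γ δ → S α → S β → S γ → S δ →
              (α + β) ≈ (γ + δ) → (α ≈ γ) ⊎ (α ≈ δ)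

  IsPartialSymmetricSidon : ∀ {p} → Pred Carrier p → Carrier → Set (c ⊔ ℓ ⊔ p)
  IsPartialSymmetricSidon S a₀ =
    S a₀ ×
    (∀ α β γ δ → S α → S β → S γ → S δ → (α + β) ≈ (γ + δ) →
       ((α ≈ γ) ⊎ (α ≈ δ)) ⊎ (((α + β) ≈ a₀) × ((γ + δ) ≈ a₀)))

  DisjointFromNeg : ∀ {p} → Pred Carrier p → Set (c ⊔ p)
  DisjointFromNeg T = ∀ x → T x → T (- x) → ⊥

{-# OPTIONS --safe #-}
module Submission where

open import Defs
open import Level using (Level; _⊔_)
open import Algebra.Bundles using (AbelianGroup)
open import Relation.Unary using (Pred; _∩_)
open import Relation.Nullary using (¬_)
open import Data.Product using (_,_)
open import Data.Sum using (inj₁; inj₂)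
open import Data.Empty using (⊥-elim)
import Algebra.Properties.Group as GroupProperties

-- In a partial symmetric Sidon set the only non-trivial coincidences α + β ≈ γ + δ
-- have both sums equal to the center, so restricting to a set T with no pair
-- summing to the center leaves a Sidon set. For center 0, a pair α + β ≈ 0 in T
-- would give β ≈ -α, so α and -α would both lie in T.

module _ {c ℓ : Level} (G : AbelianGroup c ℓ) where
  open AbelianGroup G renaming (_∙_ to _+_; ε to 0#; _⁻¹ to -_)
  open GroupProperties group using (inverseʳ-unique)

  NoPairSumsTo : ∀ {q} → Pred Carrier q → Carrier → Set (c ⊔ ℓ ⊔ q)
  NoPairSumsTo T a = ∀ α β → T α → T β → ¬ ((α + β) ≈ a)

  partialSymmetricSidon∩⇒sidon : ∀ {p q} {S : Pred Carrier p} {T : Pred Carrier q} {a₀ : Carrier} →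
    IsPartialSymmetricSidon G S a₀ → NoPairSumsTo T a₀ → IsSidon G (S ∩ T)
  partialSymmetricSidon∩⇒sidon (_ , coincidence) noPair α β γ δ (sα , tα) (sβ , tβ) (sγ , _) (sδ , _) eq
    with coincidence α β γ δ sα sβ sγ sδ eq
  ... | inj₁ trivial      = trivial
  ... | inj₂ (α+β≈a₀ , _) = ⊥-elim (noPair α β tα tβ α+β≈a₀)

  disjointFromNeg⇒noPairSumsTo0 : ∀ {q} {T : Pred Carrier q} →
    WellDefined G T → DisjointFromNeg G T → NoPairSumsTo T 0#
  disjointFromNeg⇒noPairSumsTo0 wdT disjoint α β tα tβ α+β≈0 =
    disjoint α tα (wdT (inverseʳ-unique α β α+β≈0) tβ)

lemma5p1 : {c ℓ p q : Level} (G : AbelianGroup c ℓ) → FiniteGroup G →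
    (S : Pred (AbelianGroup.Carrier G) p) (T : Pred (AbelianGroup.Carrier G) q) →
    WellDefined G S → WellDefined G T →
    IsPartialSymmetricSidon G S (AbelianGroup.ε G) →
    DisjointFromNeg G T →
    IsSidon G (S ∩ T)
lemma5p1 G _ _ _ _ wdT partialSidon disjoint =
  partialSymmetricSidon∩⇒sidon G partialSidon (disjointFromNeg⇒noPairSumsTo0 G wdT disjoint)
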